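{- In an MR geometry $(\mathcal S,\chi)$: (1) for every line $\ell$ there are at least $3$ red points and at least $3$ green points not on $\ell$; (2) there are at least $6$ red points and at least $6$ green points.
   Context: A finite linear space consists of a finite set of points and a set of lines (sets of points) such that any two distinct points lie on exactly one common line, every line has at least two points, and not all points are on one line. An MR geometry $(\mathcal S,\chi)$ is a finite linear space $\mathcal S$ with a colouring $\chi$ of each point red or green such that every line contains at least one red and at least one green point. -}

module Defs where

open import Data.Nat using (ℕ; _≤_)
open import Data.Bool using (Bool; true; false)
open import Data.Fin using (Fin)
open import Data.Fin.Subset using (Subset; _∈_; _∉_; ∣_∣; _∩_; ∁)
open import Data.Vec using (tabulate)
open import Data.Product using (Σ; _×_; ∃; ∃-syntax)
open import Relation.Binary.PropositionalEquality using (_≡_)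
open import Relation.Nullary using (¬_)
open import Function.Definitions using (Injective)

-- A finite linear space on the point set Fin v with b lines.
-- Lines are given by an injective family  line : Fin b → Subset v
-- (so the set of lines is the image, with no repetitions).
record LinearSpace (v b : ℕ) : Set where
  field
    line : Fin b → Subset v
    line-injective : Injective _≡_ _≡_ line
    line-size : ∀ l → 2 ≤ ∣ line l ∣
    join : ∀ p q → ¬ (p ≡ q) → ∃[ l ] (p ∈ line l × q ∈ line l)
    join-unique : ∀ p q → ¬ (p ≡ q) → ∀ l l′ →
      p ∈ line l → q ∈ line l → p ∈ line l′ → q ∈ line l′ → l ≡ l′
    -- non-degeneracy: there is at least one line (equivalently, at least
    -- two points); excludes the empty / one-point space
    some-line : Fin b
    nontrivial : ∀ l → ∃[ p ] (p ∉ line l)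

-- A colouring: true = red, false = green.
Colouring : ℕ → Set
Colouring v = Fin v → Bool

reds : ∀ {v} → Colouring v → Subset v
reds χ = tabulate χ

greens : ∀ {v} → Colouring v → Subset v
greens χ = ∁ (reds χ)

record MRGeometry (v b : ℕ) : Set where
  field
    space : LinearSpace v b
    χ : Colouring v
  open LinearSpace space public
  field
    has-red   : ∀ l → ∃[ p ] (p ∈ line l × χ p ≡ true)
    has-green : ∀ l → ∃[ p ] (p ∈ line l × χ p ≡ false)

{-# OPTIONS --safe #-}
module Submission where

-- Everything is proved for an arbitrary colour κ; the other colour is `not κ`.
--
-- (1) Let s be a κ-point off ℓ, q a κ-point of ℓ and x a point of the other colour on sq.
-- Every line joining x to a point g of ℓ of the other colour carries a κ-point off ℓ, and this
-- point is not s, because the only line through x and s is sq, which meets ℓ in q. So if all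
-- κ-points off ℓ were among s and t, all these lines would pass through t; choosing g on st
-- (possible) then puts s on xg as well.
--
-- (2) Two κ-points on a line and three off it give five. If there were no sixth, then by (1)
-- and ∣K∣ = ∣K ∩ l∣ + ∣K ∩ ∁ l∣ no line would carry three, so the κ-points would be five points
-- a, …, e, no three collinear. Call a point of the other colour on the line through two of them
-- a mark of that secant. No mark g lies on two disjoint secants ab, cd: the lines through g and
-- a, c, e would cover all points, and so would those through the mark U of ae (which then lies
-- on cd) and a, c, b; the marks of ac and ad, lying on both ge and Ub, would put b on ge.
-- Consequently the marks of ab and cd are collinear with e, those of ab and ac with d or e, and
-- the marks of ab, ac, bc lie on one line through d or e. A line through e and these marks also
-- collects the marks of bd and ae, hence a; then the mark of ab lies on two secants through a.

open import Defs
open import Data.Bool using (Bool; true; false; not)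
import Data.Bool.Properties as Bool
open import Data.Empty using (⊥; ⊥-elim)
open import Data.Fin using (Fin)
open import Data.Fin.Patterns using (0F; 1F; 2F; 3F; 4F)
open import Data.Fin.Permutation using (Permutation′; _⟨$⟩ʳ_; _⟨$⟩ˡ_; inverseʳ; transpose; _∘ₚ_)
open import Data.Fin.Properties using (_≟_; any?)
open import Data.Fin.Subset using (Subset; inside; outside; _∈_; _∉_; ∣_∣; _∩_; ∁)
open import Data.Fin.Subset.Properties
  using (_∈?_; x∈p∩q⁺; x∉p⇒x∈∁p; x∈p∧x≢y⇒x∈p-y; x∈p⇒∣p-x∣<∣p∣)
open import Data.Nat using (ℕ; suc; _+_; _≤_; s≤s; z≤n; _≤?_)
open import Data.Nat.Properties using (≤-trans; +-suc; +-mono-≤)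
open import Data.Product using (Σ-syntax; ∃; ∃-syntax; _×_; _,_; proj₁; proj₂)
open import Data.Sum using (_⊎_; inj₁; inj₂)
open import Data.Vec using (Vec; []; _∷_; lookup; tabulate)
open import Data.Vec.Properties using (lookup∘tabulate; lookup⇒[]=; []=⇒lookup)
open import Data.Vec.Relation.Unary.All as All using (All; []; _∷_)
import Data.Vec.Relation.Unary.All.Properties as All
open import Data.Vec.Relation.Unary.AllPairs using ([]; _∷_)
open import Data.Vec.Relation.Unary.Unique.Propositional using (Unique)
import Data.Vec.Relation.Unary.Unique.Propositional.Properties as Unique
open import Function.Bundles using (Injection)
open import Level using (0ℓ)
open import Function.Properties.Inverse using (↔⇒↣)
open import Relation.Binary.PropositionalEquality
  using (_≡_; _≢_; refl; sym; trans; cong; subst; ≢-sym)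
open import Relation.Nullary using (¬_; yes; no; ¬?)
open import Relation.Nullary.Decidable using (_×-dec_; decidable-stable; False; toWitnessFalse)
open import Relation.Unary using (Pred; Decidable)

∣p∩q∣+∣p∩∁q∣≡∣p∣ : ∀ {n} (p q : Subset n) → ∣ p ∩ q ∣ + ∣ p ∩ ∁ q ∣ ≡ ∣ p ∣
∣p∩q∣+∣p∩∁q∣≡∣p∣ []            []            = refl
∣p∩q∣+∣p∩∁q∣≡∣p∣ (inside ∷ p)  (inside ∷ q)  = cong suc (∣p∩q∣+∣p∩∁q∣≡∣p∣ p q)
∣p∩q∣+∣p∩∁q∣≡∣p∣ (inside ∷ p)  (outside ∷ q) =
  trans (+-suc ∣ p ∩ q ∣ ∣ p ∩ ∁ q ∣) (cong suc (∣p∩q∣+∣p∩∁q∣≡∣p∣ p q))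
∣p∩q∣+∣p∩∁q∣≡∣p∣ (outside ∷ p) (_ ∷ q)       = ∣p∩q∣+∣p∩∁q∣≡∣p∣ p q

Unique∧⊆p⇒m≤∣p∣ : ∀ {n m} {p : Subset n} {xs : Vec (Fin n) m} →
                  Unique xs → All (_∈ p) xs → m ≤ ∣ p ∣
Unique∧⊆p⇒m≤∣p∣ [] [] = z≤n
Unique∧⊆p⇒m≤∣p∣ (x≢xs ∷ xs-unique) (x∈p ∷ xs⊆p) =
  ≤-trans (s≤s (Unique∧⊆p⇒m≤∣p∣ xs-unique
                 (All.map (λ (x≢y , y∈p) → x∈p∧x≢y⇒x∈p-y y∈p (≢-sym x≢y)) (All.zip (x≢xs , xs⊆p)))))
          (x∈p⇒∣p-x∣<∣p∣ x∈p)

¬⊆pair⇒∃-third : ∀ {n ℓ} {P : Pred (Fin n) ℓ} → Decidable P → ∀ x y →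
                 ¬ (∀ z → P z → z ≡ x ⊎ z ≡ y) → ∃[ z ] (P z × z ≢ x × z ≢ y)
¬⊆pair⇒∃-third {P = P} P? x y ¬⊆pair with any? (λ z → P? z ×-dec ¬? (z ≟ x) ×-dec ¬? (z ≟ y))
... | yes third = third
... | no ∄third = ⊥-elim (¬⊆pair ⊆pair)
  where
  ⊆pair : ∀ z → P z → z ≡ x ⊎ z ≡ y
  ⊆pair z pz with z ≟ x | z ≟ y
  ... | yes z≡x | _       = inj₁ z≡x
  ... | no _    | yes z≡y = inj₂ z≡y
  ... | no z≢x  | no z≢y  = ⊥-elim (∄third (z , pz , z≢x , z≢y))

⊎₃-third : ∀ {a b c} {A : Set a} {B : Set b} {C : Set c} → A ⊎ B ⊎ C → ¬ A → ¬ B → C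
⊎₃-third (inj₁ x)        ¬A _  = ⊥-elim (¬A x)
⊎₃-third (inj₂ (inj₁ y)) _  ¬B = ⊥-elim (¬B y)
⊎₃-third (inj₂ (inj₂ z)) _  _  = z

module Geometry {v b : ℕ} (G : MRGeometry v b) where
  open MRGeometry G

  K : Bool → Subset v
  K true  = reds χ
  K false = greens χ

  ∈K : ∀ {κ p} → χ p ≡ κ → p ∈ K κ
  ∈K {true}  {p} χp≡κ = lookup⇒[]= p (tabulate χ) (trans (lookup∘tabulate χ p) χp≡κ)
  ∈K {false} {p} χp≡κ = x∉p⇒x∈∁p λ p∈reds →
    Bool.not-¬ χp≡κ (trans (sym (lookup∘tabulate χ p)) ([]=⇒lookup p∈reds))

  coloured-point : ∀ κ l → ∃[ p ] (p ∈ line l × χ p ≡ κ)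
  coloured-point true  = has-red
  coloured-point false = has-green

  point-of : Bool → Fin b → Fin v
  point-of κ l = proj₁ (coloured-point κ l)

  point-of-∈ : ∀ κ l → point-of κ l ∈ line l
  point-of-∈ κ l = proj₁ (proj₂ (coloured-point κ l))

  point-of-colour : ∀ κ l → χ (point-of κ l) ≡ κ
  point-of-colour κ l = proj₂ (proj₂ (coloured-point κ l))

  line-through : ∀ {p q} → p ≢ q → Fin b
  line-through p≢q = proj₁ (join _ _ p≢q)

  ∈-line-throughˡ : ∀ {p q} (p≢q : p ≢ q) → p ∈ line (line-through p≢q)
  ∈-line-throughˡ p≢q = proj₁ (proj₂ (join _ _ p≢q))

  ∈-line-throughʳ : ∀ {p q} (p≢q : p ≢ q) → q ∈ line (line-through p≢q)
  ∈-line-throughʳ p≢q = proj₂ (proj₂ (join _ _ p≢q))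

  ≢-by-colour : ∀ {κ p q} → χ p ≡ κ → χ q ≡ not κ → p ≢ q
  ≢-by-colour χp≡κ χq≡¬κ refl = Bool.not-¬ χp≡κ χq≡¬κ

  ∈∉⇒≢ : ∀ {p q l} → p ∈ line l → q ∉ line l → p ≢ q
  ∈∉⇒≢ p∈l q∉l refl = q∉l p∈l

  same-line : ∀ {p q r l m} → p ≢ q → p ∈ line l → q ∈ line l → p ∈ line m → q ∈ line m →
              r ∈ line l → r ∈ line m
  same-line p≢q p∈l q∈l p∈m q∈m = subst (λ n → _ ∈ line n) (join-unique _ _ p≢q _ _ p∈l q∈l p∈m q∈m)

  meets-once : ∀ {y w r ℓ m} → y ∉ line ℓ → y ∈ line m → w ∈ line ℓ → w ∈ line m →
               r ∈ line m → r ≢ w → r ∉ line ℓ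
  meets-once y∉ℓ y∈m w∈ℓ w∈m r∈m r≢w r∈ℓ = y∉ℓ (same-line r≢w r∈m w∈m r∈ℓ w∈ℓ y∈m)

  Off : Bool → Fin b → Pred (Fin v) 0ℓ
  Off κ ℓ p = χ p ≡ κ × p ∉ line ℓ

  off? : ∀ κ ℓ → Decidable (Off κ ℓ)
  off? κ ℓ p = (χ p Bool.≟ κ) ×-dec ¬? (p ∈? line ℓ)

  off-on-join : ∀ {κ ℓ y w m} → y ∉ line ℓ → y ∈ line m → w ∈ line ℓ → w ∈ line m →
                χ w ≡ not κ → Off κ ℓ (point-of κ m)
  off-on-join {κ} {m = m} y∉ℓ y∈m w∈ℓ w∈m w-colour =
    point-of-colour κ m ,
    meets-once y∉ℓ y∈m w∈ℓ w∈m (point-of-∈ κ m) (≢-by-colour (point-of-colour κ m) w-colour)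

  off-point : ∀ κ ℓ → ∃ (Off κ ℓ)
  off-point κ ℓ with nontrivial ℓ
  ... | y , y∉ℓ = point-of κ (line-through y≢g) ,
                  off-on-join y∉ℓ (∈-line-throughˡ y≢g) g∈ℓ (∈-line-throughʳ y≢g) (point-of-colour (not κ) ℓ)
    where
    g∈ℓ = point-of-∈ (not κ) ℓ
    y≢g = ≢-sym (∈∉⇒≢ g∈ℓ y∉ℓ)

  module OffPair {κ ℓ s t} (s-off : Off κ ℓ s) (⊆pair : ∀ r → Off κ ℓ r → r ≡ s ⊎ r ≡ t) where

    s∉ℓ : s ∉ line ℓ
    s∉ℓ = proj₂ s-off

    q∈ℓ : point-of κ ℓ ∈ line ℓ
    q∈ℓ = point-of-∈ κ ℓ

    s≢q : s ≢ point-of κ ℓ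
    s≢q = ≢-sym (∈∉⇒≢ q∈ℓ s∉ℓ)

    x : Fin v
    x = point-of (not κ) (line-through s≢q)

    x-colour : χ x ≡ not κ
    x-colour = point-of-colour (not κ) (line-through s≢q)

    x∉ℓ : x ∉ line ℓ
    x∉ℓ = meets-once s∉ℓ (∈-line-throughˡ s≢q) q∈ℓ (∈-line-throughʳ s≢q)
                     (point-of-∈ (not κ) (line-through s≢q)) (≢-sym (≢-by-colour (point-of-colour κ ℓ) x-colour))

    x≢ : ∀ {g} → g ∈ line ℓ → x ≢ g
    x≢ g∈ℓ = ≢-sym (∈∉⇒≢ g∈ℓ x∉ℓ)

    xg : ∀ {g} → g ∈ line ℓ → Fin b
    xg g∈ℓ = line-through (x≢ g∈ℓ)

    s∉xg : ∀ {g} (g∈ℓ : g ∈ line ℓ) → χ g ≡ not κ → s ∉ line (xg g∈ℓ)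
    s∉xg g∈ℓ g-colour s∈xg = s∉ℓ (same-line q≢g q∈xg (∈-line-throughʳ (x≢ g∈ℓ)) q∈ℓ g∈ℓ s∈xg)
      where
      q≢g = ≢-by-colour (point-of-colour κ ℓ) g-colour
      q∈xg = same-line (≢-by-colour (proj₁ s-off) x-colour)
                       (∈-line-throughˡ s≢q) (point-of-∈ (not κ) (line-through s≢q))
                       s∈xg (∈-line-throughˡ (x≢ g∈ℓ)) (∈-line-throughʳ s≢q)

    t∈xg : ∀ {g} (g∈ℓ : g ∈ line ℓ) → χ g ≡ not κ → t ∈ line (xg g∈ℓ) × χ t ≡ κ
    t∈xg g∈ℓ g-colour
      with ⊆pair (point-of κ (xg g∈ℓ))
                 (off-on-join x∉ℓ (∈-line-throughˡ (x≢ g∈ℓ)) g∈ℓ (∈-line-throughʳ (x≢ g∈ℓ)) g-colour)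
    ... | inj₁ r≡s = ⊥-elim (s∉xg g∈ℓ g-colour (subst (λ p → p ∈ line (xg g∈ℓ)) r≡s (point-of-∈ κ (xg g∈ℓ))))
    ... | inj₂ r≡t = subst (λ p → p ∈ line (xg g∈ℓ)) r≡t (point-of-∈ κ (xg g∈ℓ)) ,
                     subst (λ p → χ p ≡ κ) r≡t (point-of-colour κ (xg g∈ℓ))

    s≢t : s ≢ t
    s≢t refl = s∉xg g∈ℓ g-colour (proj₁ (t∈xg g∈ℓ g-colour))
      where
      g∈ℓ = point-of-∈ (not κ) ℓ
      g-colour = point-of-colour (not κ) ℓ

    off∈st : ∀ {r} → Off κ ℓ r → r ∈ line (line-through s≢t)
    off∈st {r} r-off with ⊆pair r r-off
    ... | inj₁ refl = ∈-line-throughˡ s≢t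
    ... | inj₂ refl = ∈-line-throughʳ s≢t

    other-colour-on-ℓ∩st : ∃[ g ] (g ∈ line ℓ × χ g ≡ not κ × g ∈ line (line-through s≢t))
    other-colour-on-ℓ∩st with point-of (not κ) (line-through s≢t) ∈? line ℓ
    ... | yes z∈ℓ = _ , z∈ℓ , point-of-colour (not κ) _ , point-of-∈ (not κ) _
    ... | no z∉ℓ = _ , g∈ℓ , g-colour , same-line r≢z (point-of-∈ κ _) z∈zg (off∈st r-off) z∈st g∈zg
      where
      g∈ℓ = point-of-∈ (not κ) ℓ
      g-colour = point-of-colour (not κ) ℓ
      z≢g = ≢-sym (∈∉⇒≢ g∈ℓ z∉ℓ)
      z∈zg = ∈-line-throughˡ z≢g
      g∈zg = ∈-line-throughʳ z≢g
      z∈st = point-of-∈ (not κ) (line-through s≢t)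
      r-off = off-on-join z∉ℓ z∈zg g∈ℓ g∈zg g-colour
      r≢z = ≢-by-colour (proj₁ r-off) (point-of-colour (not κ) (line-through s≢t))

    absurd : ⊥
    absurd with other-colour-on-ℓ∩st
    ... | g , g∈ℓ , g-colour , g∈st = s∉xg g∈ℓ g-colour s∈xg
      where
      t-on-xg = t∈xg g∈ℓ g-colour
      s∈xg = same-line (≢-by-colour (proj₂ t-on-xg) g-colour) (∈-line-throughʳ s≢t) g∈st
                       (proj₁ t-on-xg) (∈-line-throughʳ (x≢ g∈ℓ)) (∈-line-throughˡ s≢t)

  ¬off⊆pair : ∀ {κ ℓ s t} → Off κ ℓ s → ¬ (∀ r → Off κ ℓ r → r ≡ s ⊎ r ≡ t)
  ¬off⊆pair s-off ⊆pair = OffPair.absurd s-off ⊆pair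

  three-off : ∀ κ ℓ → Σ[ xs ∈ Vec (Fin v) 3 ] (Unique xs × All (Off κ ℓ) xs)
  three-off κ ℓ with off-point κ ℓ
  ... | r₁ , r₁-off with ¬⊆pair⇒∃-third (off? κ ℓ) r₁ r₁ (¬off⊆pair r₁-off)
  ... | r₂ , r₂-off , r₂≢r₁ , _ with ¬⊆pair⇒∃-third (off? κ ℓ) r₁ r₂ (¬off⊆pair r₁-off)
  ... | r₃ , r₃-off , r₃≢r₁ , r₃≢r₂ =
    r₁ ∷ r₂ ∷ r₃ ∷ [] ,
    ((≢-sym r₂≢r₁ ∷ ≢-sym r₃≢r₁ ∷ []) ∷ (≢-sym r₃≢r₂ ∷ []) ∷ [] ∷ []) ,
    r₁-off ∷ r₂-off ∷ r₃-off ∷ []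

  off⇒∈K∩∁line : ∀ {κ ℓ p} → Off κ ℓ p → p ∈ K κ ∩ ∁ (line ℓ)
  off⇒∈K∩∁line (p-colour , p∉ℓ) = x∈p∩q⁺ (∈K p-colour , x∉p⇒x∈∁p p∉ℓ)

  3≤∣K∩∁line∣ : ∀ κ ℓ → 3 ≤ ∣ K κ ∩ ∁ (line ℓ) ∣
  3≤∣K∩∁line∣ κ ℓ =
    let (_ , unique , off) = three-off κ ℓ in Unique∧⊆p⇒m≤∣p∣ unique (All.map off⇒∈K∩∁line off)

  five-κ-points : ∀ κ → Σ[ xs ∈ Vec (Fin v) 5 ] (Unique xs × All (λ p → χ p ≡ κ) xs)
  five-κ-points κ = extend (off-point κ some-line)
    where
    a∈ℓ₀ = point-of-∈ κ some-line
    extend : ∃ (Off κ some-line) → Σ[ xs ∈ Vec (Fin v) 5 ] (Unique xs × All (λ p → χ p ≡ κ) xs)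
    extend (b , b-colour , b∉ℓ₀) =
      let (cde , cde-unique , cde-off) = three-off κ (line-through a≢b) in
      point-of κ some-line ∷ b ∷ cde ,
      ((a≢b ∷ All.map (λ (_ , p∉ab) → ∈∉⇒≢ (∈-line-throughˡ a≢b) p∉ab) cde-off)
         ∷ All.map (λ (_ , p∉ab) → ∈∉⇒≢ (∈-line-throughʳ a≢b) p∉ab) cde-off
         ∷ cde-unique) ,
      point-of-colour κ some-line ∷ b-colour ∷ All.map proj₁ cde-off
      where a≢b = ∈∉⇒≢ a∈ℓ₀ b∉ℓ₀

  record Enumerates (κ : Bool) (xs : Vec (Fin v) 5) : Set where
    field
      unique   : Unique xs
      coloured : All (λ p → χ p ≡ κ) xs
      complete : ∀ {p} → χ p ≡ κ → ∃[ i ] lookup xs i ≡ p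

  enumerates : ∀ {κ xs} → ¬ 6 ≤ ∣ K κ ∣ → Unique xs → All (λ p → χ p ≡ κ) xs → Enumerates κ xs
  enumerates {κ} {xs} ¬6≤∣K∣ unique coloured = record { unique = unique ; coloured = coloured ; complete = complete }
    where
    complete : ∀ {p} → χ p ≡ κ → ∃[ i ] lookup xs i ≡ p
    complete {p} p-colour with any? (λ i → lookup xs i ≟ p)
    ... | yes found = found
    ... | no ¬found = ⊥-elim (¬6≤∣K∣ (Unique∧⊆p⇒m≤∣p∣
            (All.lookup⁻ (λ i p≡xᵢ → ¬found (i , sym p≡xᵢ)) ∷ unique)
            (All.map ∈K (p-colour ∷ coloured))))

  module FivePoints (κ : Bool) (≤2-on-lines : ∀ l → ¬ 3 ≤ ∣ K κ ∩ line l ∣) where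

    -- Relabelling by a permutation reduces symmetric cases to one another.
    relabel : ∀ {xs} → Enumerates κ xs → (σ : Permutation′ 5) →
              Enumerates κ (tabulate (λ i → lookup xs (σ ⟨$⟩ʳ i)))
    relabel {xs} E σ = record
      { unique   = Unique.tabulate⁺ λ eq →
                     Injection.injective (↔⇒↣ σ) (Unique.lookup-injective unique _ _ eq)
      ; coloured = All.tabulate⁺ λ i → All.lookup⁺ coloured (σ ⟨$⟩ʳ i)
      ; complete = λ χp≡κ → let (i , xᵢ≡p) = complete χp≡κ in
          σ ⟨$⟩ˡ i ,
          trans (lookup∘tabulate (λ k → lookup xs (σ ⟨$⟩ʳ k)) (σ ⟨$⟩ˡ i))
                (trans (cong (lookup xs) (inverseʳ σ)) xᵢ≡p)
      }
      where open Enumerates E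

    Collinear : Fin v → Fin v → Fin v → Set
    Collinear x y z = ∃[ l ] (x ∈ line l × y ∈ line l × z ∈ line l)

    OnSecant : Fin v → Fin v → Fin v → Set
    OnSecant x y p = χ p ≡ not κ × Collinear x y p

    OnSecant-sym : ∀ {x y p} → OnSecant x y p → OnSecant y x p
    OnSecant-sym (p-colour , l , x∈l , y∈l , p∈l) = p-colour , l , y∈l , x∈l , p∈l

    -- The index-distinctness arguments `False (i ≟ j)` compute to ⊤ at literal indices,
    -- so they are filled in automatically there.
    module Enumerated {xs} (E : Enumerates κ xs) where
      open Enumerates E

      colour : ∀ i → χ (lookup xs i) ≡ κ
      colour = All.lookup⁺ coloured

      distinct : ∀ i j {i≢j : False (i ≟ j)} → lookup xs i ≢ lookup xs j
      distinct i j {i≢j} eq = toWitnessFalse i≢j (Unique.lookup-injective unique i j eq)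

      ≢-opposite : ∀ i {p} → χ p ≡ not κ → lookup xs i ≢ p
      ≢-opposite i = ≢-by-colour (colour i)

      κ-index-on : ∀ l → ∃[ i ] lookup xs i ∈ line l
      κ-index-on l with complete (point-of-colour κ l)
      ... | i , xᵢ≡p = i , subst (λ p → p ∈ line l) (sym xᵢ≡p) (point-of-∈ κ l)

      toward-κ-point : ∀ {g} → χ g ≡ not κ → ∀ p →
                       ∃[ i ] (∀ {l} → lookup xs i ∈ line l → g ∈ line l → p ∈ line l)
      toward-κ-point {g} g-colour p with p ≟ g
      ... | yes refl = 0F , λ _ g∈l → g∈l
      ... | no p≢g with κ-index-on (line-through p≢g)
      ...   | i , xᵢ∈gp = i , λ xᵢ∈l g∈l →
        same-line (≢-opposite i g-colour) xᵢ∈gp (∈-line-throughʳ p≢g) xᵢ∈l g∈l (∈-line-throughˡ p≢g)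

      not-collinear : ∀ i j k {i≢j : False (i ≟ j)} {i≢k : False (i ≟ k)} {j≢k : False (j ≟ k)} {l} →
                      lookup xs i ∈ line l → lookup xs j ∈ line l → lookup xs k ∈ line l → ⊥
      not-collinear i j k {i≢j} {i≢k} {j≢k} {l} xᵢ∈l xⱼ∈l xₖ∈l = ≤2-on-lines l (Unique∧⊆p⇒m≤∣p∣
        ((distinct i j {i≢j} ∷ distinct i k {i≢k} ∷ []) ∷ (distinct j k {j≢k} ∷ []) ∷ [] ∷ [])
        (x∈p∩q⁺ (∈K (colour i) , xᵢ∈l) ∷ x∈p∩q⁺ (∈K (colour j) , xⱼ∈l) ∷ x∈p∩q⁺ (∈K (colour k) , xₖ∈l) ∷ []))

      ¬mark-on-secants-through : ∀ i j k {i≢j : False (i ≟ j)} {i≢k : False (i ≟ k)} {j≢k : False (j ≟ k)} {p} →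
        OnSecant (lookup xs i) (lookup xs j) p → OnSecant (lookup xs i) (lookup xs k) p → ⊥
      ¬mark-on-secants-through i j k {i≢j} {i≢k} {j≢k} (p-colour , l , xᵢ∈l , xⱼ∈l , p∈l) (_ , m , xᵢ∈m , xₖ∈m , p∈m) =
        not-collinear i j k {i≢j} {i≢k} {j≢k} xᵢ∈l xⱼ∈l (same-line (≢-opposite i p-colour) xᵢ∈m p∈m xᵢ∈l p∈l xₖ∈m)

      mark : ∀ i j {i≢j : False (i ≟ j)} → Fin v
      mark i j {i≢j} = point-of (not κ) (line-through (distinct i j {i≢j}))

      mark-on-secant : ∀ i j {i≢j : False (i ≟ j)} → OnSecant (lookup xs i) (lookup xs j) (mark i j {i≢j})
      mark-on-secant i j {i≢j} =
        point-of-colour (not κ) l , l , ∈-line-throughˡ xᵢ≢xⱼ , ∈-line-throughʳ xᵢ≢xⱼ , point-of-∈ (not κ) l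
        where
        xᵢ≢xⱼ = distinct i j {i≢j}
        l = line-through xᵢ≢xⱼ

    module _ {a b c d e} (E : Enumerates κ (a ∷ b ∷ c ∷ d ∷ e ∷ [])) where
      open Enumerated E

      lines-through-mark-cover : ∀ {g L} → OnSecant a b g → OnSecant c d g → g ∈ line L → e ∈ line L →
                                 ∀ p → Collinear a b p ⊎ Collinear c d p ⊎ p ∈ line L
      lines-through-mark-cover (g-colour , l₁ , a∈l₁ , b∈l₁ , g∈l₁) (_ , l₂ , c∈l₂ , d∈l₂ , g∈l₂) g∈L e∈L p
        with toward-κ-point g-colour p
      ... | 0F , on = inj₁ (l₁ , a∈l₁ , b∈l₁ , on a∈l₁ g∈l₁)
      ... | 1F , on = inj₁ (l₁ , a∈l₁ , b∈l₁ , on b∈l₁ g∈l₁)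
      ... | 2F , on = inj₂ (inj₁ (l₂ , c∈l₂ , d∈l₂ , on c∈l₂ g∈l₂))
      ... | 3F , on = inj₂ (inj₁ (l₂ , c∈l₂ , d∈l₂ , on d∈l₂ g∈l₂))
      ... | 4F , on = inj₂ (inj₂ (on e∈L g∈L))

    module _ {a b c d e} (E : Enumerates κ (a ∷ b ∷ c ∷ d ∷ e ∷ [])) where
      open Enumerated E

      ac-mark∈ge : ∀ {g L X} → OnSecant a b g → OnSecant c d g → g ∈ line L → e ∈ line L →
                   OnSecant a c X → X ∈ line L
      ac-mark∈ge g-ab g-cd g∈L e∈L X-ac@(X-colour , _) =
        ⊎₃-third (lines-through-mark-cover E g-ab g-cd g∈L e∈L _)
          (λ X-ab → ¬mark-on-secants-through 0F 2F 1F X-ac (X-colour , X-ab))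
          (λ X-cd → ¬mark-on-secants-through 2F 0F 3F (OnSecant-sym X-ac) (X-colour , X-cd))

      ae-mark-on-cd : ∀ {g U} → OnSecant a b g → OnSecant c d g → OnSecant a e U → OnSecant c d U
      ae-mark-on-cd g-ab@(g-colour , _) g-cd U-ae@(U-colour , lae , a∈lae , e∈lae , U∈lae)
        with lines-through-mark-cover E g-ab g-cd (∈-line-throughˡ g≢e) (∈-line-throughʳ g≢e) _
        where g≢e = ≢-sym (≢-opposite 4F g-colour)
      ... | inj₁ U-ab        = ⊥-elim (¬mark-on-secants-through 0F 4F 1F U-ae (U-colour , U-ab))
      ... | inj₂ (inj₁ U-cd) = U-colour , U-cd
      ... | inj₂ (inj₂ U∈ge) = ⊥-elim (¬mark-on-secants-through 0F 4F 1F (g-colour , _ , a∈ge , e∈ge , g∈ge) g-ab)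
        where
        g≢e = ≢-sym (≢-opposite 4F g-colour)
        g∈ge = ∈-line-throughˡ g≢e
        e∈ge = ∈-line-throughʳ g≢e
        a∈ge = same-line (≢-sym (≢-opposite 4F U-colour)) U∈lae e∈lae U∈ge e∈ge a∈lae

    module _ {a b c d e} (E : Enumerates κ (a ∷ b ∷ c ∷ d ∷ e ∷ [])) where
      open Enumerated E

      ¬mark-on-disjoint-secants : ∀ {g} → OnSecant a b g → OnSecant c d g → ⊥
      ¬mark-on-disjoint-secants g-ab@(g-colour , _) g-cd =
        refute (mark-on-secant 0F 2F) (mark-on-secant 0F 3F) (mark-on-secant 0F 4F)
        where
        g≢e = ≢-sym (≢-opposite 4F g-colour)
        g∈ge = ∈-line-throughˡ g≢e
        e∈ge = ∈-line-throughʳ g≢e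
        refute : ∀ {X Y U} → OnSecant a c X → OnSecant a d Y → OnSecant a e U → ⊥
        refute {X} {Y} {U} X-ac Y-ad U-ae@(U-colour , _) =
          ¬mark-on-secants-through 1F 4F 0F (g-colour , _ , b∈ge , e∈ge , g∈ge) (OnSecant-sym g-ab)
          where
          U-cd = ae-mark-on-cd E g-ab g-cd U-ae
          U≢b = ≢-sym (≢-opposite 1F U-colour)
          U∈Ub = ∈-line-throughˡ U≢b
          b∈Ub = ∈-line-throughʳ U≢b
          X∈ge = ac-mark∈ge E g-ab g-cd g∈ge e∈ge X-ac
          Y∈ge = ac-mark∈ge (relabel E (transpose 2F 3F)) g-ab (OnSecant-sym g-cd) g∈ge e∈ge Y-ad
          X∈Ub = ac-mark∈ge (relabel E (transpose 1F 4F)) U-ae U-cd U∈Ub b∈Ub X-ac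
          Y∈Ub = ac-mark∈ge (relabel E (transpose 1F 4F ∘ₚ transpose 2F 3F)) U-ae (OnSecant-sym U-cd)
                            U∈Ub b∈Ub Y-ad
          X≢Y : X ≢ Y
          X≢Y refl = ¬mark-on-secants-through 0F 2F 3F X-ac Y-ad
          b∈ge : b ∈ line (line-through g≢e)
          b∈ge = same-line X≢Y X∈Ub Y∈Ub X∈ge Y∈ge b∈Ub

      marks-on-disjoint-secants : ∀ {P Q} → OnSecant a b P → OnSecant c d Q → Collinear P Q e
      marks-on-disjoint-secants P-ab@(P-colour , l₁ , a∈l₁ , b∈l₁ , P∈l₁) Q-cd@(Q-colour , l₂ , c∈l₂ , d∈l₂ , Q∈l₂)
        with join _ _ (λ { refl → ¬mark-on-disjoint-secants P-ab Q-cd })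
      ... | n , P∈n , Q∈n with κ-index-on n
      ...   | 0F , a∈n = ⊥-elim (¬mark-on-disjoint-secants (Q-colour , l₁ , a∈l₁ , b∈l₁ , Q∈l₁) Q-cd)
        where Q∈l₁ = same-line (≢-opposite 0F P-colour) a∈n P∈n a∈l₁ P∈l₁ Q∈n
      ...   | 1F , b∈n = ⊥-elim (¬mark-on-disjoint-secants (Q-colour , l₁ , a∈l₁ , b∈l₁ , Q∈l₁) Q-cd)
        where Q∈l₁ = same-line (≢-opposite 1F P-colour) b∈n P∈n b∈l₁ P∈l₁ Q∈n
      ...   | 2F , c∈n = ⊥-elim (¬mark-on-disjoint-secants P-ab (P-colour , l₂ , c∈l₂ , d∈l₂ , P∈l₂))
        where P∈l₂ = same-line (≢-opposite 2F Q-colour) c∈n Q∈n c∈l₂ Q∈l₂ P∈n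
      ...   | 3F , d∈n = ⊥-elim (¬mark-on-disjoint-secants P-ab (P-colour , l₂ , c∈l₂ , d∈l₂ , P∈l₂))
        where P∈l₂ = same-line (≢-opposite 3F Q-colour) d∈n Q∈n d∈l₂ Q∈l₂ P∈n
      ...   | 4F , e∈n = n , P∈n , Q∈n , e∈n

      marks-on-adjacent-secants : ∀ {P Q} → OnSecant a b P → OnSecant a c Q → Collinear P Q d ⊎ Collinear P Q e
      marks-on-adjacent-secants P-ab@(P-colour , l₁ , a∈l₁ , b∈l₁ , P∈l₁) Q-ac@(Q-colour , l₂ , a∈l₂ , c∈l₂ , Q∈l₂)
        with join _ _ (λ { refl → ¬mark-on-secants-through 0F 1F 2F P-ab Q-ac })
      ... | n , P∈n , Q∈n with κ-index-on n
      ...   | 0F , a∈n = ⊥-elim (¬mark-on-secants-through 0F 1F 2F (Q-colour , l₁ , a∈l₁ , b∈l₁ , Q∈l₁) Q-ac)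
        where Q∈l₁ = same-line (≢-opposite 0F P-colour) a∈n P∈n a∈l₁ P∈l₁ Q∈n
      ...   | 1F , b∈n = ⊥-elim (¬mark-on-secants-through 0F 1F 2F (Q-colour , l₁ , a∈l₁ , b∈l₁ , Q∈l₁) Q-ac)
        where Q∈l₁ = same-line (≢-opposite 1F P-colour) b∈n P∈n b∈l₁ P∈l₁ Q∈n
      ...   | 2F , c∈n = ⊥-elim (¬mark-on-secants-through 0F 1F 2F P-ab (P-colour , l₂ , a∈l₂ , c∈l₂ , P∈l₂))
        where P∈l₂ = same-line (≢-opposite 2F Q-colour) c∈n Q∈n c∈l₂ Q∈l₂ P∈n
      ...   | 3F , d∈n = inj₁ (n , P∈n , Q∈n , d∈n)
      ...   | 4F , e∈n = inj₂ (n , P∈n , Q∈n , e∈n)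

    module _ {a b c d e} (E : Enumerates κ (a ∷ b ∷ c ∷ d ∷ e ∷ [])) where
      open Enumerated E

      marks-on-triangle : ∀ {P Q R} → OnSecant a b P → OnSecant a c Q → OnSecant b c R →
                          ∃[ L ] (P ∈ line L × Q ∈ line L × R ∈ line L × (d ∈ line L ⊎ e ∈ line L))
      marks-on-triangle {P} {Q} {R} P-ab@(P-colour , _) Q-ac@(Q-colour , _) R-bc@(R-colour , _) =
        combine (marks-on-adjacent-secants E P-ab Q-ac)
                (marks-on-adjacent-secants (relabel E (transpose 0F 1F)) (OnSecant-sym P-ab) R-bc)
                (marks-on-adjacent-secants (relabel E (transpose 0F 2F)) (OnSecant-sym R-bc) (OnSecant-sym Q-ac))
        where
        Goal : Set
        Goal = ∃[ L ] (P ∈ line L × Q ∈ line L × R ∈ line L × (d ∈ line L ⊎ e ∈ line L))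
        combine : Collinear P Q d ⊎ Collinear P Q e → Collinear P R d ⊎ Collinear P R e →
                  Collinear R Q d ⊎ Collinear R Q e → Goal
        combine (inj₁ (n₁ , P∈n₁ , Q∈n₁ , d∈n₁)) (inj₁ (n₂ , P∈n₂ , R∈n₂ , d∈n₂)) _ =
          n₁ , P∈n₁ , Q∈n₁ , same-line (≢-sym (≢-opposite 3F P-colour)) P∈n₂ d∈n₂ P∈n₁ d∈n₁ R∈n₂ , inj₁ d∈n₁
        combine (inj₂ (n₁ , P∈n₁ , Q∈n₁ , e∈n₁)) (inj₂ (n₂ , P∈n₂ , R∈n₂ , e∈n₂)) _ =
          n₁ , P∈n₁ , Q∈n₁ , same-line (≢-sym (≢-opposite 4F P-colour)) P∈n₂ e∈n₂ P∈n₁ e∈n₁ R∈n₂ , inj₂ e∈n₁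
        combine (inj₁ (n₁ , P∈n₁ , Q∈n₁ , d∈n₁)) _ (inj₁ (n₃ , R∈n₃ , Q∈n₃ , d∈n₃)) =
          n₁ , P∈n₁ , Q∈n₁ , same-line (≢-sym (≢-opposite 3F Q-colour)) Q∈n₃ d∈n₃ Q∈n₁ d∈n₁ R∈n₃ , inj₁ d∈n₁
        combine (inj₂ (n₁ , P∈n₁ , Q∈n₁ , e∈n₁)) _ (inj₂ (n₃ , R∈n₃ , Q∈n₃ , e∈n₃)) =
          n₁ , P∈n₁ , Q∈n₁ , same-line (≢-sym (≢-opposite 4F Q-colour)) Q∈n₃ e∈n₃ Q∈n₁ e∈n₁ R∈n₃ , inj₂ e∈n₁
        combine (inj₁ _) (inj₂ (n₂ , P∈n₂ , R∈n₂ , e∈n₂)) (inj₂ (n₃ , R∈n₃ , Q∈n₃ , e∈n₃)) =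
          n₂ , P∈n₂ , same-line (≢-sym (≢-opposite 4F R-colour)) R∈n₃ e∈n₃ R∈n₂ e∈n₂ Q∈n₃ , R∈n₂ , inj₂ e∈n₂
        combine (inj₂ _) (inj₁ (n₂ , P∈n₂ , R∈n₂ , d∈n₂)) (inj₁ (n₃ , R∈n₃ , Q∈n₃ , d∈n₃)) =
          n₂ , P∈n₂ , same-line (≢-sym (≢-opposite 3F R-colour)) R∈n₃ d∈n₃ R∈n₂ d∈n₂ Q∈n₃ , R∈n₂ , inj₁ d∈n₂

      ¬marks-on-triangle-collinear-with-e : ∀ {P Q R L} → OnSecant a b P → OnSecant a c Q → OnSecant b c R →
                                            P ∈ line L → Q ∈ line L → R ∈ line L → e ∈ line L → ⊥
      ¬marks-on-triangle-collinear-with-e {P} {Q} {R} {L} P-ab@(P-colour , _) Q-ac@(Q-colour , _) R-bc P∈L Q∈L R∈L e∈L =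
        refute (mark-on-secant 0F 4F) (mark-on-secant 1F 3F)
        where
        refute : ∀ {U W} → OnSecant a e U → OnSecant b d W → ⊥
        refute {U} {W} U-ae@(U-colour , _ , a∈ae , e∈ae , U∈ae) W-bd =
          ¬mark-on-secants-through 0F 1F 4F P-ab (P-colour , L , a∈L , e∈L , P∈L)
          where
          W∈L : W ∈ line L
          W∈L with marks-on-disjoint-secants (relabel E (transpose 1F 2F)) Q-ac W-bd
          ... | n , Q∈n , W∈n , e∈n = same-line (≢-sym (≢-opposite 4F Q-colour)) Q∈n e∈n Q∈L e∈L W∈n
          U∈L : U ∈ line L
          U∈L with marks-on-adjacent-secants (relabel E (transpose 2F 4F)) P-ab U-ae
          ... | inj₁ (n , P∈n , U∈n , d∈n)
            with marks-on-disjoint-secants (relabel E (transpose 0F 2F ∘ₚ transpose 3F 4F))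
                                           (OnSecant-sym R-bc) U-ae
          ...   | n′ , R∈n′ , U∈n′ , d∈n′ = same-line P≢R P∈n R∈n P∈L R∈L U∈n
            where
            P≢R : P ≢ R
            P≢R refl = ¬mark-on-secants-through 1F 0F 2F (OnSecant-sym P-ab) R-bc
            R∈n = same-line (≢-sym (≢-opposite 3F U-colour)) U∈n′ d∈n′ U∈n d∈n R∈n′
          U∈L | inj₂ (n , P∈n , U∈n , c∈n)
            with marks-on-disjoint-secants (relabel E (transpose 0F 3F ∘ₚ transpose 2F 4F))
                                           (OnSecant-sym W-bd) (OnSecant-sym U-ae)
          ...   | n′ , W∈n′ , U∈n′ , c∈n′ = same-line P≢W P∈n W∈n P∈L W∈L U∈n
            where
            P≢W : P ≢ W
            P≢W refl = ¬mark-on-secants-through 1F 0F 3F (OnSecant-sym P-ab) W-bd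
            W∈n = same-line (≢-sym (≢-opposite 2F U-colour)) U∈n′ c∈n′ U∈n c∈n W∈n′
          a∈L : a ∈ line L
          a∈L = same-line (≢-sym (≢-opposite 4F U-colour)) U∈ae e∈ae U∈L e∈L a∈ae

    no-enumeration : ∀ {xs} → Enumerates κ xs → ⊥
    no-enumeration {a ∷ b ∷ c ∷ d ∷ e ∷ []} E =
      refute (mark-on-secant 0F 1F) (mark-on-secant 0F 2F) (mark-on-secant 1F 2F)
      where
      open Enumerated E
      refute : ∀ {P Q R} → OnSecant a b P → OnSecant a c Q → OnSecant b c R → ⊥
      refute P-ab Q-ac R-bc with marks-on-triangle E P-ab Q-ac R-bc
      ... | L , P∈L , Q∈L , R∈L , inj₁ d∈L =
        ¬marks-on-triangle-collinear-with-e (relabel E (transpose 3F 4F)) P-ab Q-ac R-bc P∈L Q∈L R∈L d∈L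
      ... | L , P∈L , Q∈L , R∈L , inj₂ e∈L =
        ¬marks-on-triangle-collinear-with-e E P-ab Q-ac R-bc P∈L Q∈L R∈L e∈L

  6≤∣K∣ : ∀ κ → 6 ≤ ∣ K κ ∣
  6≤∣K∣ κ = decidable-stable (6 ≤? ∣ K κ ∣) λ ¬6≤∣K∣ →
    let (xs , unique , coloured) = five-κ-points κ in
    FivePoints.no-enumeration κ (≤2-on-lines ¬6≤∣K∣) (enumerates ¬6≤∣K∣ unique coloured)
    where
    ≤2-on-lines : ¬ 6 ≤ ∣ K κ ∣ → ∀ l → ¬ 3 ≤ ∣ K κ ∩ line l ∣
    ≤2-on-lines ¬6≤∣K∣ l 3≤∣K∩l∣ = ¬6≤∣K∣ (subst (6 ≤_) (∣p∩q∣+∣p∩∁q∣≡∣p∣ (K κ) (line l))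
                                                        (+-mono-≤ 3≤∣K∩l∣ (3≤∣K∩∁line∣ κ l)))

lemma3p5 : ∀ {v b} (G : MRGeometry v b) →
    let open MRGeometry G in
    (∀ l → (3 ≤ ∣ reds χ ∩ ∁ (line l) ∣) × (3 ≤ ∣ greens χ ∩ ∁ (line l) ∣))
    × ((6 ≤ ∣ reds χ ∣) × (6 ≤ ∣ greens χ ∣))
lemma3p5 G = (λ l → 3≤∣K∩∁line∣ true l , 3≤∣K∩∁line∣ false l) , 6≤∣K∣ true , 6≤∣K∣ false
  where open Geometry G
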